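{- Let $n \in \mathbb{N}$ and suppose $n = m + d^+(v_m)$ where $m = d^+(v_n)$. Let $j_{\max}$ be the largest integer $j$ with $0 \le j < m$ such that $d^+(v_{m-j}) - j \geq 1$. Then $$\epsilon(J_n(1)) = \frac{1}{2}\left(\sum_{i=1}^{m} i + \sum_{i=0}^{j_{\max}} \bigl(d^+(v_{m-i}) - i\bigr) + d^+(v_m)\bigl(d^+(v_m)-1\bigr)\right).$$
   Context: The infinite Jaco graph $J_\infty(1)$ is the directed graph with vertex set $\{v_i : i \in \mathbb{N}\}$ ($\mathbb{N}=\{1,2,3,\dots\}$) whose arcs are defined recursively: for $i<j$, $(v_i,v_j)$ is an arc if and only if $2i - d^-(v_i) \geq j$, where $d^-(v_i)$ is the in-degree of $v_i$ (which depends only on arcs with tails $v_k$, $k<i$); there are no other arcs. For $n \in \mathbb{N}$, the finite Jaco graph $J_n(1)$ is the subgraph of $J_\infty(1)$ induced on $\{v_1,\dots,v_n\}$. $\epsilon(G)$ denotes the number of edges (arcs) of $G$. Here $d^+(v_i)$ denotes the out-degree of $v_i$ in the infinite graph $J_\infty(1)$, which equals $i - d^-(v_i)$. -}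

module Defs where

open import Data.Nat using (ℕ; zero; suc; _+_; _*_; _∸_; _≤ᵇ_; _<ᵇ_)
open import Data.Bool using (Bool; true; false; if_then_else_; _∧_)
open import Data.List using (List; []; _∷_; _++_; [_]; map; upTo; foldr)
open import Data.Nat.ListAction using (sum)
open import Data.Integer using (ℤ)
import Data.Integer as ℤ

-- Vertices v_i are indexed by i ≥ 1 (index 0 is unused).
-- inFrom ds k j : given the list ds = [d⁻(v_k), d⁻(v_{k+1}), …, d⁻(v_{j-1})],
-- counts the vertices v_i (k ≤ i < j) with 2i - d⁻(v_i) ≥ j, i.e. the arcs (v_i , v_j).
inFrom : List ℕ → ℕ → ℕ → ℕ
inFrom []       i j = 0
inFrom (d ∷ ds) i j = (if j ≤ᵇ (2 * i ∸ d) then 1 else 0) + inFrom ds (suc i) j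

inList : ℕ → List ℕ
inList zero    = []
inList (suc n) = inList n ++ [ inFrom (inList n) 1 (suc n) ]

indeg : ℕ → ℕ
indeg zero    = 0
indeg (suc n) = inFrom (inList n) 1 (suc n)

outdeg : ℕ → ℕ
outdeg i = i ∸ indeg i

arcᵇ : ℕ → ℕ → Bool
arcᵇ i j = (i <ᵇ j) ∧ (j ≤ᵇ (2 * i ∸ indeg i))

1to : ℕ → List ℕ
1to n = map suc (upTo n)

edges : ℕ → ℕ
edges n = sum (map (λ i → sum (map (λ j → if arcᵇ i j then 1 else 0) (1to n))) (1to n))

sumℤ : List ℤ → ℤ
sumℤ = foldr ℤ._+_ (ℤ.+ 0)

module Submission where

-- Write a(i) = d⁻(v_i), b(i) = d⁺(v_i) = i − a(i) and reach(i) = 2i − a(i) = i + b(i):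
-- the arcs leaving v_i are exactly those into v_{i+1}, …, v_{reach(i)}.
--  1. Unfolding the recursive definition, a(n+1) counts the i ≤ n with reach(i) ≥ n+1.
--     Raising the threshold from n+1 to n+2 can only lower that count, so
--     a(n+2) ≤ a(n+1) + 1; hence b, and with it reach, is non-decreasing.
--  2. Row i of the adjacency matrix of J_n(1) holds min(n, reach(i)) − i arcs.  For
--     n = reach(m) = m + b(m) the rows i ≤ m contribute b(i) and the rows m+1+k contribute
--     b(m) − 1 − k, so  ε(J_n(1)) = Σ_{i≤m} b(i) + Σ_{k<b(m)} k.
--  3. Double counting the arcs leaving {v_1,…,v_m}:  2 Σ_{i≤m} b(i) = Σ_{i≤m} i + X_m,
--     where X_m = Σ_{k≤m} (reach(k) − m) counts the arcs from {v_1,…,v_m} to later vertices.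
--  4. The paper's sum Σ_{i≤jmax} (b(m−i) − i) is X_m read backwards: the terms of X_m are
--     reach(m−i) − m = b(m−i) − i, non-negative for i ≤ jmax by monotonicity of b and
--     zero for i > jmax by the maximality of jmax.

open import Defs
open import Data.Nat using (ℕ; _≤_; _<_; _∸_; _+_)
open import Data.Integer using (ℤ; +_; _-_; _*_)
import Data.Integer as ℤ
open import Data.List using (map; upTo)
open import Data.Nat.ListAction using (sum)
open import Relation.Binary.PropositionalEquality using (_≡_)

import Data.Nat as ℕ
open import Data.Nat using (zero; suc; _≤ᵇ_; _<ᵇ_; _⊓_; z≤n; s≤s; _≤?_; _≤′_; ≤′-refl; ≤′-step)
open import Data.Nat.Properties
open import Data.Nat.ListAction.Properties using (sum-++)
open import Data.Nat.Tactic.RingSolver using (solve-∀)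
import Data.Integer.Properties as ℤ
import Data.Integer.Tactic.RingSolver as ℤ
open import Data.Bool using (Bool; true; false; if_then_else_; _∧_)
open import Data.Bool.Properties using (∧-identityʳ; ∧-zeroʳ)
open import Data.List using ([]; _∷_; _++_; [_]; length; applyUpTo)
open import Data.List.Properties using (applyUpTo-∷ʳ; map-upTo; map-∘; length-++)
open import Function using (_∘_)
open import Relation.Binary.PropositionalEquality using (refl; sym; trans; cong; cong₂; subst; subst₂; module ≡-Reasoning)
open import Relation.Nullary using (yes; no; contradiction)

-- ∑[ i < n ] f i = f 0 + … + f (n − 1), built by appending the last term,
-- just as the list of in-degrees is built.
∑ : ℕ → (ℕ → ℕ) → ℕ
∑ zero    f = 0
∑ (suc n) f = ∑ n f + f n

syntax ∑ n (λ i → e) = ∑[ i < n ] e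

∑-cong : ∀ n {f g : ℕ → ℕ} → (∀ i → i < n → f i ≡ g i) → ∑ n f ≡ ∑ n g
∑-cong zero    eq = refl
∑-cong (suc n) eq = cong₂ _+_ (∑-cong n (λ i i<n → eq i (m≤n⇒m≤1+n i<n))) (eq n ≤-refl)

∑-mono : ∀ n {f g : ℕ → ℕ} → (∀ i → f i ≤ g i) → ∑ n f ≤ ∑ n g
∑-mono zero    le = z≤n
∑-mono (suc n) le = +-mono-≤ (∑-mono n le) (le n)

∑-ones : ∀ n → ∑[ i < n ] 1 ≡ n
∑-ones zero    = refl
∑-ones (suc n) = trans (cong (_+ 1) (∑-ones n)) (+-comm n 1)

∑-+ : ∀ n (f g : ℕ → ℕ) → ∑[ i < n ] (f i + g i) ≡ ∑ n f + ∑ n g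
∑-+ zero    f g = refl
∑-+ (suc n) f g = trans (cong (_+ (f n + g n)) (∑-+ n f g)) (interchange (∑ n f) (∑ n g) (f n) (g n))
  where
  interchange : ∀ a b c d → (a + b) + (c + d) ≡ (a + c) + (b + d)
  interchange = solve-∀

∑-split : ∀ m k (f : ℕ → ℕ) → ∑ (m + k) f ≡ ∑ m f + ∑[ i < k ] f (m + i)
∑-split m zero    f = trans (cong (λ t → ∑ t f) (+-identityʳ m)) (sym (+-identityʳ (∑ m f)))
∑-split m (suc k) f = begin
  ∑ (m + suc k) f                                  ≡⟨ cong (λ t → ∑ t f) (+-suc m k) ⟩
  ∑ (m + k) f + f (m + k)                          ≡⟨ cong (_+ f (m + k)) (∑-split m k f) ⟩
  (∑ m f + ∑[ i < k ] f (m + i)) + f (m + k)       ≡⟨ +-assoc (∑ m f) _ _ ⟩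
  ∑ m f + ∑[ i < suc k ] f (m + i)                 ∎
  where open ≡-Reasoning

∑-cons : ∀ n (f : ℕ → ℕ) → ∑ (suc n) f ≡ f 0 + ∑[ i < n ] f (suc i)
∑-cons = ∑-split 1

∑-reverse : ∀ n (f : ℕ → ℕ) → ∑ n f ≡ ∑[ i < n ] f (n ∸ suc i)
∑-reverse zero    f = refl
∑-reverse (suc n) f = begin
  ∑ n f + f n                           ≡⟨ cong (_+ f n) (∑-reverse n f) ⟩
  ∑[ i < n ] f (n ∸ suc i) + f n        ≡⟨ +-comm _ (f n) ⟩
  f n + ∑[ i < n ] f (n ∸ suc i)        ≡⟨ sym (∑-cons n (λ i → f (n ∸ i))) ⟩
  ∑[ i < suc n ] f (suc n ∸ suc i)      ∎
  where open ≡-Reasoning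

∑-extend : ∀ {n m} (f : ℕ → ℕ) → n ≤ m → (∀ i → n ≤ i → i < m → f i ≡ 0) → ∑ m f ≡ ∑ n f
∑-extend {n} f n≤m = go (≤⇒≤′ n≤m)
  where
  open ≡-Reasoning
  go : ∀ {m} → n ≤′ m → (∀ i → n ≤ i → i < m → f i ≡ 0) → ∑ m f ≡ ∑ n f
  go ≤′-refl               vanish = refl
  go (≤′-step {m} n≤′m)    vanish = begin
    ∑ m f + f m   ≡⟨ cong₂ _+_ (go n≤′m (λ i n≤i i<m → vanish i n≤i (m≤n⇒m≤1+n i<m)))
                               (vanish m (≤′⇒≤ n≤′m) ≤-refl) ⟩
    ∑ n f + 0     ≡⟨ +-identityʳ (∑ n f) ⟩
    ∑ n f         ∎

gauss : ∀ n → 2 ℕ.* ∑[ k < n ] k + n ≡ n ℕ.* n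
gauss zero    = refl
gauss (suc n) = begin
  2 ℕ.* (s + n) + suc n          ≡⟨ regroup s n ⟩
  (2 ℕ.* s + n) + (2 ℕ.* n + 1)  ≡⟨ cong (_+ (2 ℕ.* n + 1)) (gauss n) ⟩
  n ℕ.* n + (2 ℕ.* n + 1)        ≡⟨ square n ⟩
  suc n ℕ.* suc n                ∎
  where
  open ≡-Reasoning
  s = ∑[ k < n ] k
  regroup : ∀ s n → 2 ℕ.* (s + n) + suc n ≡ (2 ℕ.* s + n) + (2 ℕ.* n + 1)
  regroup = solve-∀
  square : ∀ n → n ℕ.* n + (2 ℕ.* n + 1) ≡ suc n ℕ.* suc n
  square = solve-∀

sumℤ-applyUpTo : ∀ (φ : ℕ → ℤ) (ψ : ℕ → ℕ) n → (∀ i → i < n → φ i ≡ + ψ i) →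
                 sumℤ (applyUpTo φ n) ≡ + ∑ n ψ
sumℤ-applyUpTo φ ψ zero    eq = refl
sumℤ-applyUpTo φ ψ (suc n) eq = begin
  φ 0 ℤ.+ sumℤ (applyUpTo (φ ∘ suc) n)   ≡⟨ cong₂ ℤ._+_ (eq 0 (s≤s z≤n))
                                              (sumℤ-applyUpTo (φ ∘ suc) (ψ ∘ suc) n
                                                 (λ i i<n → eq (suc i) (s≤s i<n))) ⟩
  + ψ 0 ℤ.+ + ∑[ i < n ] ψ (suc i)       ≡⟨ sym (ℤ.pos-+ (ψ 0) _) ⟩
  + (ψ 0 + ∑[ i < n ] ψ (suc i))         ≡⟨ cong +_ (sym (∑-cons n ψ)) ⟩
  + ∑ (suc n) ψ                          ∎
  where open ≡-Reasoning

sum-applyUpTo : ∀ (f : ℕ → ℕ) n → sum (applyUpTo f n) ≡ ∑ n f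
sum-applyUpTo f zero    = refl
sum-applyUpTo f (suc n) = begin
  sum (applyUpTo f (suc n))         ≡⟨ cong sum (sym (applyUpTo-∷ʳ f n)) ⟩
  sum (applyUpTo f n ++ [ f n ])    ≡⟨ sum-++ (applyUpTo f n) [ f n ] ⟩
  sum (applyUpTo f n) + (f n + 0)   ≡⟨ cong₂ _+_ (sum-applyUpTo f n) (+-identityʳ (f n)) ⟩
  ∑ n f + f n                       ∎
  where open ≡-Reasoning

sum-upTo : ∀ (f : ℕ → ℕ) n → sum (map f (upTo n)) ≡ ∑ n f
sum-upTo f n = trans (cong sum (map-upTo f n)) (sum-applyUpTo f n)

sum-1to : ∀ (f : ℕ → ℕ) n → sum (map f (1to n)) ≡ ∑[ i < n ] f (suc i)
sum-1to f n = trans (cong sum (sym (map-∘ (upTo n)))) (sum-upTo (f ∘ suc) n)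

⟦_⟧ : Bool → ℕ
⟦ b ⟧ = if b then 1 else 0

⟦⟧≤1 : ∀ b → ⟦ b ⟧ ≤ 1
⟦⟧≤1 true  = ≤-refl
⟦⟧≤1 false = z≤n

≤ᵇ-true : ∀ {j x} → j ≤ x → (j ≤ᵇ x) ≡ true
≤ᵇ-true {j} {x} j≤x with j ≤ᵇ x | ≤⇒≤ᵇ j≤x
... | true | _ = refl

≤ᵇ-false : ∀ {j x} → x < j → (j ≤ᵇ x) ≡ false
≤ᵇ-false {j} {x} x<j with j ≤ᵇ x | ≤ᵇ⇒≤ j x
... | true  | j≤x = contradiction (j≤x _) (<⇒≱ x<j)
... | false | _   = refl

threshold-mono : ∀ t x → ⟦ suc t ≤ᵇ x ⟧ ≤ ⟦ t ≤ᵇ x ⟧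
threshold-mono t x with suc t ≤? x
... | yes t<x rewrite ≤ᵇ-true t<x | ≤ᵇ-true (<⇒≤ t<x) = ≤-refl
... | no  t≮x rewrite ≤ᵇ-false (≰⇒> t≮x) = z≤n

-- x ∸ q counts the thresholds q < t ≤ x; peel off the first one.
∸-step : ∀ x q → x ∸ q ≡ x ∸ suc q + ⟦ suc q ≤ᵇ x ⟧
∸-step zero    q       = 0∸n≡0 q
∸-step (suc x) zero    = +-comm 1 x
∸-step (suc x) (suc q) = ∸-step x q

-- v_i has arcs exactly to v_{i+1}, …, v_{reach i}.
reach : ℕ → ℕ
reach i = 2 ℕ.* i ∸ indeg i

inFrom-snoc : ∀ ds d i j →
  inFrom (ds ++ [ d ]) i j ≡ inFrom ds i j + ⟦ j ≤ᵇ 2 ℕ.* (i + length ds) ∸ d ⟧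
inFrom-snoc []       d i j =
  trans (+-identityʳ _) (cong (λ k → ⟦ j ≤ᵇ 2 ℕ.* k ∸ d ⟧) (sym (+-identityʳ i)))
inFrom-snoc (e ∷ ds) d i j = begin
  t + inFrom (ds ++ [ d ]) (suc i) j
    ≡⟨ cong (_+_ t) (inFrom-snoc ds d (suc i) j) ⟩
  t + (inFrom ds (suc i) j + ⟦ j ≤ᵇ 2 ℕ.* (suc i + length ds) ∸ d ⟧)
    ≡⟨ sym (+-assoc t _ _) ⟩
  (t + inFrom ds (suc i) j) + ⟦ j ≤ᵇ 2 ℕ.* (suc i + length ds) ∸ d ⟧
    ≡⟨ cong (λ k → (t + inFrom ds (suc i) j) + ⟦ j ≤ᵇ 2 ℕ.* k ∸ d ⟧) (sym (+-suc i (length ds))) ⟩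
  (t + inFrom ds (suc i) j) + ⟦ j ≤ᵇ 2 ℕ.* (i + suc (length ds)) ∸ d ⟧
    ∎
  where
  open ≡-Reasoning
  t = ⟦ j ≤ᵇ 2 ℕ.* i ∸ e ⟧

length-inList : ∀ n → length (inList n) ≡ n
length-inList zero    = refl
length-inList (suc n) = trans (length-++ (inList n)) (trans (+-comm _ 1) (cong suc (length-inList n)))

earlier-reaching : ∀ n j → inFrom (inList n) 1 j ≡ ∑[ i < n ] ⟦ j ≤ᵇ reach (suc i) ⟧
earlier-reaching zero    j = refl
earlier-reaching (suc n) j = begin
  inFrom (inList n ++ [ indeg (suc n) ]) 1 j
    ≡⟨ inFrom-snoc (inList n) (indeg (suc n)) 1 j ⟩
  inFrom (inList n) 1 j + ⟦ j ≤ᵇ 2 ℕ.* suc (length (inList n)) ∸ indeg (suc n) ⟧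
    ≡⟨ cong₂ (λ s k → s + ⟦ j ≤ᵇ 2 ℕ.* suc k ∸ indeg (suc n) ⟧) (earlier-reaching n j) (length-inList n) ⟩
  ∑[ i < n ] ⟦ j ≤ᵇ reach (suc i) ⟧ + ⟦ j ≤ᵇ reach (suc n) ⟧
    ∎
  where open ≡-Reasoning

-- v_i has at most i − 1 in-neighbours, so d⁺(v_i) = i − d⁻(v_i) is exact.
indeg-≤ : ∀ i → indeg i ≤ i
indeg-≤ zero    = z≤n
indeg-≤ (suc n) = m≤n⇒m≤1+n (begin
  indeg (suc n)                              ≡⟨ earlier-reaching n (suc n) ⟩
  ∑[ i < n ] ⟦ suc n ≤ᵇ reach (suc i) ⟧      ≤⟨ ∑-mono n (λ i → ⟦⟧≤1 _) ⟩
  ∑[ i < n ] 1                               ≡⟨ ∑-ones n ⟩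
  n                                          ∎)
  where open ≤-Reasoning

indeg-suc-≤ : ∀ i → indeg (suc i) ≤ suc (indeg i)
indeg-suc-≤ zero    = z≤n
indeg-suc-≤ (suc n) = begin
  indeg (suc (suc n))
    ≡⟨ earlier-reaching (suc n) (suc (suc n)) ⟩
  ∑[ i < n ] ⟦ suc (suc n) ≤ᵇ reach (suc i) ⟧ + ⟦ suc (suc n) ≤ᵇ reach (suc n) ⟧
    ≤⟨ +-mono-≤ (∑-mono n (λ i → threshold-mono (suc n) (reach (suc i)))) (⟦⟧≤1 _) ⟩
  ∑[ i < n ] ⟦ suc n ≤ᵇ reach (suc i) ⟧ + 1
    ≡⟨ cong (_+ 1) (sym (earlier-reaching n (suc n))) ⟩
  indeg (suc n) + 1
    ≡⟨ +-comm _ 1 ⟩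
  suc (indeg (suc n))
    ∎
  where open ≤-Reasoning

-- Step 1 of the plan: d⁺ is non-decreasing, since d⁺(v_{i+1}) ≥ (i+1) − (d⁻(v_i) + 1).
outdeg-mono : ∀ {i j} → i ≤ j → outdeg i ≤ outdeg j
outdeg-mono i≤j = go (≤⇒≤′ i≤j)
  where
  go : ∀ {i j} → i ≤′ j → outdeg i ≤ outdeg j
  go ≤′-refl          = ≤-refl
  go (≤′-step {j} p)  = ≤-trans (go p) (∸-monoʳ-≤ (suc j) (indeg-suc-≤ j))

indeg+outdeg : ∀ i → indeg i + outdeg i ≡ i
indeg+outdeg i = m+[n∸m]≡n (indeg-≤ i)

reach-outdeg : ∀ i → reach i ≡ i + outdeg i
reach-outdeg i = trans (cong (_∸ indeg i) (cong (_+_ i) (+-identityʳ i))) (+-∸-assoc i (indeg-≤ i))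

reach∸self : ∀ i → reach i ∸ i ≡ outdeg i
reach∸self i = trans (cong (_∸ i) (reach-outdeg i)) (m+n∸m≡n i (outdeg i))

reach-mono : ∀ {i j} → i ≤ j → reach i ≤ reach j
reach-mono {i} {j} i≤j = subst₂ _≤_ (sym (reach-outdeg i)) (sym (reach-outdeg j))
                                  (+-mono-≤ i≤j (outdeg-mono i≤j))

reach-beyond : ∀ {i m} → i ≤ m → reach (m ∸ i) ∸ m ≡ outdeg (m ∸ i) ∸ i
reach-beyond {i} {m} i≤m = begin
  reach (m ∸ i) ∸ m                        ≡⟨ cong₂ _∸_ (reach-outdeg (m ∸ i)) (sym (m∸n+n≡m i≤m)) ⟩
  (m ∸ i + outdeg (m ∸ i)) ∸ (m ∸ i + i)   ≡⟨ [m+n]∸[m+o]≡n∸o (m ∸ i) (outdeg (m ∸ i)) i ⟩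
  outdeg (m ∸ i) ∸ i                       ∎
  where open ≡-Reasoning

outArcs : ℕ → ℕ → ℕ
outArcs n i = ∑[ j < n ] ⟦ arcᵇ i (suc j) ⟧

edges-by-rows : ∀ n → edges n ≡ ∑[ i < n ] outArcs n (suc i)
edges-by-rows n = trans (sum-1to _ n) (∑-cong n (λ i _ → sum-1to _ n))

outArcs-min : ∀ n i → outArcs n i ≡ (n ⊓ reach i) ∸ i
outArcs-min zero    i = sym (0∸n≡0 i)
outArcs-min (suc n) i with suc n ≤? reach i
... | yes n<r = begin
  outArcs n i + ⟦ (i <ᵇ suc n) ∧ (suc n ≤ᵇ reach i) ⟧
    ≡⟨ cong₂ (λ a b → a + ⟦ (i <ᵇ suc n) ∧ b ⟧) (outArcs-min n i) (≤ᵇ-true n<r) ⟩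
  (n ⊓ reach i) ∸ i + ⟦ (i <ᵇ suc n) ∧ true ⟧
    ≡⟨ cong₂ (λ a b → a ∸ i + ⟦ b ⟧) (m≤n⇒m⊓n≡m (<⇒≤ n<r)) (∧-identityʳ _) ⟩
  n ∸ i + ⟦ i <ᵇ suc n ⟧
    ≡⟨ sym (∸-step (suc n) i) ⟩
  suc n ∸ i
    ≡⟨ cong (_∸ i) (sym (m≤n⇒m⊓n≡m n<r)) ⟩
  (suc n ⊓ reach i) ∸ i
    ∎
  where open ≡-Reasoning
... | no n≮r = begin
  outArcs n i + ⟦ (i <ᵇ suc n) ∧ (suc n ≤ᵇ reach i) ⟧
    ≡⟨ cong₂ (λ a b → a + ⟦ (i <ᵇ suc n) ∧ b ⟧) (outArcs-min n i) (≤ᵇ-false (≰⇒> n≮r)) ⟩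
  (n ⊓ reach i) ∸ i + ⟦ (i <ᵇ suc n) ∧ false ⟧
    ≡⟨ cong (λ b → (n ⊓ reach i) ∸ i + ⟦ b ⟧) (∧-zeroʳ _) ⟩
  (n ⊓ reach i) ∸ i + 0
    ≡⟨ +-identityʳ _ ⟩
  (n ⊓ reach i) ∸ i
    ≡⟨ cong (_∸ i) (trans (m≥n⇒m⊓n≡n r≤n) (sym (m≥n⇒m⊓n≡n (m≤n⇒m≤1+n r≤n)))) ⟩
  (suc n ⊓ reach i) ∸ i
    ∎
  where
  open ≡-Reasoning
  r≤n : reach i ≤ n
  r≤n = ≤-pred (≰⇒> n≮r)

-- Step 2 of the plan: for n = reach m every earlier vertex v_i keeps all its b(i) arcs,
-- and the vertex v_{m+1+k} sends b(m) − 1 − k arcs up to v_n.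
edges-at-reach : ∀ m → edges (m + outdeg m) ≡ ∑[ i < m ] outdeg (suc i) + ∑[ k < outdeg m ] k
edges-at-reach m = begin
  edges n                                                            ≡⟨ edges-by-rows n ⟩
  ∑[ i < m + B ] outArcs n (suc i)                                   ≡⟨ ∑-split m B _ ⟩
  ∑[ i < m ] outArcs n (suc i) + ∑[ k < B ] outArcs n (suc (m + k))  ≡⟨ cong₂ _+_ (∑-cong m early) (∑-cong B late) ⟩
  ∑[ i < m ] outdeg (suc i) + ∑[ k < B ] (B ∸ suc k)                 ≡⟨ cong (_+_ _) (sym (∑-reverse B (λ k → k))) ⟩
  ∑[ i < m ] outdeg (suc i) + ∑[ k < B ] k                           ∎
  where
  open ≡-Reasoning
  B = outdeg m
  n = m + B
  reach-m : reach m ≡ n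
  reach-m = reach-outdeg m
  early : ∀ i → i < m → outArcs n (suc i) ≡ outdeg (suc i)
  early i i<m = begin
    outArcs n (suc i)           ≡⟨ outArcs-min n (suc i) ⟩
    (n ⊓ reach (suc i)) ∸ suc i ≡⟨ cong (_∸ suc i) (m≥n⇒m⊓n≡n (subst (reach (suc i) ≤_) reach-m
                                                                       (reach-mono i<m))) ⟩
    reach (suc i) ∸ suc i       ≡⟨ reach∸self (suc i) ⟩
    outdeg (suc i)              ∎
  late : ∀ k → k < B → outArcs n (suc (m + k)) ≡ B ∸ suc k
  late k _ = begin
    outArcs n (suc (m + k))             ≡⟨ outArcs-min n (suc (m + k)) ⟩
    (n ⊓ reach (suc (m + k))) ∸ suc (m + k)
      ≡⟨ cong (_∸ suc (m + k)) (m≤n⇒m⊓n≡m (subst (_≤ reach (suc (m + k))) reach-m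
                                                  (reach-mono (m≤n⇒m≤1+n (m≤m+n m k))))) ⟩
    (m + B) ∸ suc (m + k)               ≡⟨ cong ((m + B) ∸_) (sym (+-suc m k)) ⟩
    (m + B) ∸ (m + suc k)               ≡⟨ [m+n]∸[m+o]≡n∸o m B (suc k) ⟩
    B ∸ suc k                           ∎

-- The arcs from {v_1, …, v_q} to vertices beyond v_q.
crossing : ℕ → ℕ
crossing q = ∑[ k < q ] (reach (suc k) ∸ q)

-- Moving the cut past v_{q+1} loses exactly the d⁻(v_{q+1}) arcs that end there.
crossing-shift : ∀ q → crossing q ≡ ∑[ k < q ] (reach (suc k) ∸ suc q) + indeg (suc q)
crossing-shift q = begin
  ∑[ k < q ] (reach (suc k) ∸ q)
    ≡⟨ ∑-cong q (λ k _ → ∸-step (reach (suc k)) q) ⟩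
  ∑[ k < q ] (reach (suc k) ∸ suc q + ⟦ suc q ≤ᵇ reach (suc k) ⟧)
    ≡⟨ ∑-+ q (λ k → reach (suc k) ∸ suc q) (λ k → ⟦ suc q ≤ᵇ reach (suc k) ⟧) ⟩
  ∑[ k < q ] (reach (suc k) ∸ suc q) + ∑[ k < q ] ⟦ suc q ≤ᵇ reach (suc k) ⟧
    ≡⟨ cong (_+_ _) (sym (earlier-reaching q (suc q))) ⟩
  ∑[ k < q ] (reach (suc k) ∸ suc q) + indeg (suc q)
    ∎
  where open ≡-Reasoning

-- Step 3 of the plan: every arc leaving {v_1, …, v_q} either ends inside (these are
-- counted by the in-degrees, d⁻(v_i) = i − d⁺(v_i)) or crosses the cut.
double-count : ∀ q → 2 ℕ.* ∑[ i < q ] outdeg (suc i) ≡ ∑[ i < q ] suc i + crossing q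
double-count zero    = refl
double-count (suc q) = begin
  2 ℕ.* (S + b)                      ≡⟨ *-distribˡ-+ 2 S b ⟩
  2 ℕ.* S + 2 ℕ.* b                  ≡⟨ cong (_+ 2 ℕ.* b) (double-count q) ⟩
  (T + crossing q) + 2 ℕ.* b         ≡⟨ cong (λ c → (T + c) + 2 ℕ.* b) (crossing-shift q) ⟩
  (T + (C + a)) + 2 ℕ.* b            ≡⟨ regroup T C a b ⟩
  (T + (a + b)) + (C + b)            ≡⟨ cong₂ (λ u v → (T + u) + (C + v)) (indeg+outdeg (suc q))
                                                                           (sym (reach∸self (suc q))) ⟩
  (T + suc q) + (C + (reach (suc q) ∸ suc q)) ∎
  where
  open ≡-Reasoning
  S = ∑[ i < q ] outdeg (suc i)
  T = ∑[ i < q ] suc i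
  C = ∑[ k < q ] (reach (suc k) ∸ suc q)
  a = indeg (suc q)
  b = outdeg (suc q)
  regroup : ∀ T C a b → (T + (C + a)) + 2 ℕ.* b ≡ (T + (a + b)) + (C + b)
  regroup = solve-∀

-- Step 4 of the plan: read backwards, the terms of crossing m are b(m−i) − i; they agree
-- with the integer terms of the paper for i ≤ jmax (monotonicity of b) and vanish for
-- jmax < i < m (maximality of jmax).
jmax-sum : ∀ m jmax → jmax < m → 1 + jmax ≤ outdeg (m ∸ jmax) →
  ((j : ℕ) → j < m → 1 + j ≤ outdeg (m ∸ j) → j ≤ jmax) →
  sumℤ (map (λ i → + outdeg (m ∸ i) - + i) (upTo (1 + jmax))) ≡ + crossing m
jmax-sum m jmax jmax<m jmax-out jmax-max = begin
  sumℤ (map φ (upTo (1 + jmax)))    ≡⟨ cong sumℤ (map-upTo φ (1 + jmax)) ⟩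
  sumℤ (applyUpTo φ (1 + jmax))     ≡⟨ sumℤ-applyUpTo φ ψ (1 + jmax) positive ⟩
  + ∑ (1 + jmax) ψ                  ≡⟨ cong +_ (sym (∑-extend ψ jmax<m vanish)) ⟩
  + ∑ m ψ                           ≡⟨ cong +_ (sym backwards) ⟩
  + crossing m                      ∎
  where
  open ≡-Reasoning
  φ : ℕ → ℤ
  φ i = + outdeg (m ∸ i) - + i
  ψ : ℕ → ℕ
  ψ i = outdeg (m ∸ i) ∸ i
  positive : ∀ i → i < 1 + jmax → φ i ≡ + ψ i
  positive i (s≤s i≤jmax) = trans (ℤ.m-n≡m⊖n _ i) (ℤ.⊖-≥ i≤out)
    where
    i≤out : i ≤ outdeg (m ∸ i)
    i≤out = ≤-trans (m≤n⇒m≤1+n i≤jmax) (≤-trans jmax-out (outdeg-mono (∸-monoʳ-≤ m i≤jmax)))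
  vanish : ∀ i → 1 + jmax ≤ i → i < m → ψ i ≡ 0
  vanish i jmax<i i<m with 1 + i ≤? outdeg (m ∸ i)
  ... | yes i<out = contradiction (jmax-max i i<m i<out) (<⇒≱ jmax<i)
  ... | no  i≮out = m≤n⇒m∸n≡0 (≤-pred (≰⇒> i≮out))
  backwards : crossing m ≡ ∑ m ψ
  backwards = trans (∑-reverse m (λ k → reach (suc k) ∸ m)) (∑-cong m λ i i<m →
    trans (cong (λ v → reach v ∸ m) (sym (+-∸-assoc 1 i<m))) (reach-beyond (<⇒≤ i<m)))

edges-formula : ∀ m → 2 ℕ.* edges (m + outdeg m)
                      ≡ (∑[ i < m ] suc i + crossing m) + 2 ℕ.* ∑[ k < outdeg m ] k
edges-formula m = begin
  2 ℕ.* edges (m + outdeg m)                     ≡⟨ cong (2 ℕ.*_) (edges-at-reach m) ⟩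
  2 ℕ.* (∑[ i < m ] outdeg (suc i) + W)          ≡⟨ *-distribˡ-+ 2 (∑[ i < m ] outdeg (suc i)) W ⟩
  2 ℕ.* ∑[ i < m ] outdeg (suc i) + 2 ℕ.* W      ≡⟨ cong (_+ 2 ℕ.* W) (double-count m) ⟩
  (∑[ i < m ] suc i + crossing m) + 2 ℕ.* W      ∎
  where
  open ≡-Reasoning
  W = ∑[ k < outdeg m ] k

triangle : ∀ B → + (2 ℕ.* ∑[ k < B ] k) ≡ + B * (+ B - + 1)
triangle B = begin
  + W2                     ≡⟨ sym (cancel (+ W2) (+ B)) ⟩
  (+ W2 ℤ.+ + B) - + B     ≡⟨ cong (_- + B) (sym (ℤ.pos-+ W2 B)) ⟩
  + (W2 + B) - + B         ≡⟨ cong (λ t → + t - + B) (gauss B) ⟩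
  + (B ℕ.* B) - + B        ≡⟨ cong (_- + B) (ℤ.pos-* B B) ⟩
  + B * + B - + B          ≡⟨ sym (expand (+ B)) ⟩
  + B * (+ B - + 1)        ∎
  where
  open ≡-Reasoning
  W2 = 2 ℕ.* ∑[ k < B ] k
  cancel : ∀ (w x : ℤ) → (w ℤ.+ x) - x ≡ w
  cancel = ℤ.solve-∀
  expand : ∀ (x : ℤ) → x * (x - + 1) ≡ x * x - x
  expand = ℤ.solve-∀

proposition2p2 : (n m jmax : ℕ) → 1 ≤ n → m ≡ outdeg n → n ≡ m + outdeg m →
    jmax < m → 1 + jmax ≤ outdeg (m ∸ jmax) →
    ((j : ℕ) → j < m → 1 + j ≤ outdeg (m ∸ j) → j ≤ jmax) →
    + 2 * + edges n
      ≡ (+ sum (1to m)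
         ℤ.+ sumℤ (map (λ i → + outdeg (m ∸ i) - + i) (upTo (1 + jmax))))
         ℤ.+ + outdeg m * (+ outdeg m - + 1)
proposition2p2 .(m + outdeg m) m jmax _ _ refl jmax<m jmax-out jmax-max = begin
  + 2 * + edges (m + B)                                     ≡⟨ sym (ℤ.pos-* 2 (edges (m + B))) ⟩
  + (2 ℕ.* edges (m + B))                                   ≡⟨ cong +_ (edges-formula m) ⟩
  + ((T + crossing m) + 2 ℕ.* W)                            ≡⟨ ℤ.pos-+ (T + crossing m) (2 ℕ.* W) ⟩
  + (T + crossing m) ℤ.+ + (2 ℕ.* W)                        ≡⟨ cong (ℤ._+ + (2 ℕ.* W)) (ℤ.pos-+ T (crossing m)) ⟩
  (+ T ℤ.+ + crossing m) ℤ.+ + (2 ℕ.* W)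
    ≡⟨ cong₂ ℤ._+_ (cong₂ ℤ._+_ (cong +_ (sym (sum-upTo suc m)))
                                (sym (jmax-sum m jmax jmax<m jmax-out jmax-max)))
                   (triangle B) ⟩
  (+ sum (1to m) ℤ.+ sumℤ (map (λ i → + outdeg (m ∸ i) - + i) (upTo (1 + jmax))))
    ℤ.+ + B * (+ B - + 1)                                   ∎
  where
  open ≡-Reasoning
  B = outdeg m
  T = ∑[ i < m ] suc i
  W = ∑[ k < B ] k
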